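{- Let $U$ be a multiset of elements of $\mathbb Z/3\mathbb Z$ consisting of $a_1$ copies of $1$ and $a_2$ copies of $2$, with $u=a_1+a_2\ge 2$. Then for every integer $\ell$ with $0\le\ell\le u-2$, $\Sigma_\ell(U)\cup\Sigma_{\ell+1}(U)\cup\Sigma_{\ell+2}(U)=\mathbb Z/3\mathbb Z$.
   Context: For a multiset $U$ in an abelian group $G$, $v_\alpha(U)$ denotes the multiplicity of $\alpha$ in $U$, and for an integer $\ell\ge 0$, $\Sigma_\ell(U)=\{\sum_{\alpha\in G}c_\alpha\alpha:\ c_\alpha\in\mathbb Z,\ 0\le c_\alpha\le v_\alpha(U),\ \sum_\alpha c_\alpha=\ell\}$. -}

module Defs where

open import Data.Nat using (ℕ; zero; suc; _+_; _*_; _≤_; _%_)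
open import Data.Fin using (Fin; toℕ; fromℕ<)
open import Data.Fin.Patterns using (0F; 1F; 2F)
open import Data.Nat.DivMod using (m%n<n)
open import Data.Product using (Σ; _×_; ∃)
open import Relation.Binary.PropositionalEquality using (_≡_)

ℤ₃ : Set
ℤ₃ = Fin 3

toℤ₃ : ℕ → ℤ₃
toℤ₃ n = fromℕ< (m%n<n n 3)

-- A finite multiset in ℤ/3ℤ, given by its multiplicity function v_α(U).
Multiset₃ : Set
Multiset₃ = ℤ₃ → ℕ

InΣ : ℕ → Multiset₃ → ℤ₃ → Set
InΣ ℓ U x =
  Σ (ℤ₃ → ℕ) λ c →
    ((α : ℤ₃) → c α ≤ U α) ×
    (c 0F + c 1F + c 2F ≡ ℓ) ×
    (toℤ₃ (c 0F * toℕ {3} 0F + c 1F * toℕ {3} 1F + c 2F * toℕ {3} 2F) ≡ x)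

mset : ℕ → ℕ → Multiset₃
mset a₁ a₂ 0F = 0
mset a₁ a₂ 1F = a₁
mset a₁ a₂ 2F = a₂

-- Choose ℓ elements of U so that at least two elements remain, and let w be
-- the sum of the chosen ones. Adding none, one or two of the remaining
-- elements gives subsums of sizes ℓ, ℓ + 1 and ℓ + 2, and whichever two
-- elements remain (two 1s, a 1 and a 2, or two 2s) the values w, w + 1 and
-- w + 2 are all reached modulo 3; for two 2s this is because w + 4 ≡ w + 1.
module Submission where

open import Defs
open import Data.Nat using (ℕ; zero; suc; _+_; _*_; _≤_; _%_; z≤n; s≤s)
open import Data.Nat.DivMod using ([m+n]%n≡m%n)
open import Data.Nat.Properties using (+-comm; +-monoʳ-≤; m≤m+n; +-suc)
open import Data.Nat.Tactic.RingSolver using (solve-∀)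
open import Data.Fin.Patterns using (0F; 1F; 2F)
open import Data.Fin.Properties using (fromℕ<-cong)
open import Data.Product using (_,_)
open import Data.Sum using (_⊎_; inj₁; inj₂)
open import Relation.Binary.PropositionalEquality using (_≡_; refl; trans; cong; subst; subst₂)

toℤ₃-periodic : ∀ n → toℤ₃ (3 + n) ≡ toℤ₃ n
toℤ₃-periodic n = fromℕ<-cong _ _ (trans (cong (_% 3) (+-comm 3 n)) ([m+n]%n≡m%n n 3)) _ _

toℤ₃-consecutive-cover : ∀ n x → toℤ₃ n ≡ x ⊎ toℤ₃ (1 + n) ≡ x ⊎ toℤ₃ (2 + n) ≡ x
toℤ₃-consecutive-cover 0 0F = inj₁ refl
toℤ₃-consecutive-cover 0 1F = inj₂ (inj₁ refl)
toℤ₃-consecutive-cover 0 2F = inj₂ (inj₂ refl)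
toℤ₃-consecutive-cover 1 0F = inj₂ (inj₂ refl)
toℤ₃-consecutive-cover 1 1F = inj₁ refl
toℤ₃-consecutive-cover 1 2F = inj₂ (inj₁ refl)
toℤ₃-consecutive-cover 2 0F = inj₂ (inj₁ refl)
toℤ₃-consecutive-cover 2 1F = inj₂ (inj₂ refl)
toℤ₃-consecutive-cover 2 2F = inj₁ refl
toℤ₃-consecutive-cover (suc (suc (suc n))) x
  rewrite toℤ₃-periodic n | toℤ₃-periodic (1 + n) | toℤ₃-periodic (2 + n) =
  toℤ₃-consecutive-cover n x

weight : ℕ → ℕ → ℕ
weight p q = p * 1 + q * 2

InΣ-mset : ∀ {a₁ a₂} p q → p ≤ a₁ → q ≤ a₂ → InΣ (p + q) (mset a₁ a₂) (toℤ₃ (weight p q))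
InΣ-mset {a₁} {a₂} p q p≤a₁ q≤a₂ = mset p q , bounded , refl , refl
  where
  bounded : ∀ α → mset p q α ≤ mset a₁ a₂ α
  bounded 0F = z≤n
  bounded 1F = p≤a₁
  bounded 2F = q≤a₂

InΣ-extend : ∀ c₁ c₂ {r₁ r₂} i j → i ≤ r₁ → j ≤ r₂ →
  InΣ (c₁ + c₂ + (i + j)) (mset (c₁ + r₁) (c₂ + r₂)) (toℤ₃ (i + 2 * j + weight c₁ c₂))
InΣ-extend c₁ c₂ {r₁} {r₂} i j i≤r₁ j≤r₂ =
  subst₂ (λ ℓ x → InΣ ℓ (mset (c₁ + r₁) (c₂ + r₂)) x) (size c₁ c₂ i j) (cong toℤ₃ (sum c₁ c₂ i j))
    (InΣ-mset (c₁ + i) (c₂ + j) (+-monoʳ-≤ c₁ i≤r₁) (+-monoʳ-≤ c₂ j≤r₂))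
  where
  size : ∀ c₁ c₂ i j → c₁ + i + (c₂ + j) ≡ c₁ + c₂ + (i + j)
  size = solve-∀
  sum : ∀ c₁ c₂ i j → (c₁ + i) * 1 + (c₂ + j) * 2 ≡ i + 2 * j + (c₁ * 1 + c₂ * 2)
  sum = solve-∀

Covered : ℕ → ℕ → ℕ → ℤ₃ → Set
Covered a₁ a₂ ℓ x = InΣ ℓ (mset a₁ a₂) x ⊎ InΣ (ℓ + 1) (mset a₁ a₂) x ⊎ InΣ (ℓ + 2) (mset a₁ a₂) x

three-levels-cover : ∀ c₁ c₂ r₁ r₂ → 2 ≤ r₁ + r₂ → ∀ x → Covered (c₁ + r₁) (c₂ + r₂) (c₁ + c₂) x
three-levels-cover c₁ c₂ r₁ r₂ 2≤r x with toℤ₃-consecutive-cover (weight c₁ c₂) x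
three-levels-cover c₁ c₂ r₁ r₂ _ _ | inj₁ refl = inj₁ (InΣ-mset c₁ c₂ (m≤m+n c₁ r₁) (m≤m+n c₂ r₂))
three-levels-cover c₁ c₂ (suc r₁) r₂ _ _ | inj₂ (inj₁ refl) =
  inj₂ (inj₁ (InΣ-extend c₁ c₂ 1 0 (s≤s z≤n) z≤n))
three-levels-cover c₁ c₂ zero (suc (suc r₂)) _ _ | inj₂ (inj₁ refl) =
  inj₂ (inj₂ (subst (InΣ _ _) (toℤ₃-periodic (1 + weight c₁ c₂))
    (InΣ-extend c₁ c₂ 0 2 z≤n (s≤s (s≤s z≤n)))))
three-levels-cover c₁ c₂ (suc (suc r₁)) r₂ _ _ | inj₂ (inj₂ refl) =
  inj₂ (inj₂ (InΣ-extend c₁ c₂ 2 0 (s≤s (s≤s z≤n)) z≤n))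
three-levels-cover c₁ c₂ r₁ (suc r₂) _ _ | inj₂ (inj₂ refl) =
  inj₂ (inj₁ (InΣ-extend c₁ c₂ 0 1 z≤n (s≤s z≤n)))
three-levels-cover c₁ c₂ zero zero () _ | inj₂ _
three-levels-cover c₁ c₂ zero (suc zero) (s≤s ()) _ | inj₂ _
three-levels-cover c₁ c₂ (suc zero) zero (s≤s ()) _ | inj₂ (inj₂ _)

-- ℓ = c₁ + c₂ chosen elements (c₁ ones, c₂ twos), leaving r₁ ones and r₂ twos.
data Split : ℕ → ℕ → ℕ → Set where
  split : ∀ c₁ c₂ r₁ r₂ → 2 ≤ r₁ + r₂ → Split (c₁ + c₂) (c₁ + r₁) (c₂ + r₂)

Split-suc₁ : ∀ {ℓ a₁ a₂} → Split ℓ a₁ a₂ → Split (suc ℓ) (suc a₁) a₂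
Split-suc₁ (split c₁ c₂ r₁ r₂ 2≤r) = split (suc c₁) c₂ r₁ r₂ 2≤r

Split-suc₂ : ∀ {ℓ a₁ a₂} → Split ℓ a₁ a₂ → Split (suc ℓ) a₁ (suc a₂)
Split-suc₂ (split c₁ c₂ r₁ r₂ 2≤r) =
  subst (λ ℓ → Split ℓ (c₁ + r₁) (suc c₂ + r₂)) (+-suc c₁ c₂) (split c₁ (suc c₂) r₁ r₂ 2≤r)

split-exists : ∀ ℓ a₁ a₂ → ℓ + 2 ≤ a₁ + a₂ → Split ℓ a₁ a₂
split-exists zero a₁ a₂ 2≤a = split 0 0 a₁ a₂ 2≤a
split-exists (suc ℓ) (suc a₁) a₂ (s≤s h) = Split-suc₁ (split-exists ℓ a₁ a₂ h)
split-exists (suc ℓ) zero (suc a₂) (s≤s h) = Split-suc₂ (split-exists ℓ zero a₂ h)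

lemma3p4 : (a₁ a₂ : ℕ) → 2 ≤ a₁ + a₂ →
    (ℓ : ℕ) → ℓ + 2 ≤ a₁ + a₂ →
    (x : ℤ₃) →
    InΣ ℓ (mset a₁ a₂) x ⊎ InΣ (ℓ + 1) (mset a₁ a₂) x ⊎ InΣ (ℓ + 2) (mset a₁ a₂) x
lemma3p4 a₁ a₂ _ ℓ ℓ+2≤a x with split-exists ℓ a₁ a₂ ℓ+2≤a
... | split c₁ c₂ r₁ r₂ 2≤r = three-levels-cover c₁ c₂ r₁ r₂ 2≤r x
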